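{- Let $J$ be the theory over the signature $(*,\to,e)$ of arities $(2,2,0)$ with axioms $x\to x\approx e$, $e\to x\approx x$, and $((x\to y)\to y)*(((x\to y)\to y)\to x)\approx x$. Write $x\le y$ for the equation $x\to y\approx e$ and let $\theta(x_0,x_1,x_2)=(x_1\to x_0)*x_2$, $\theta_1(x,y)=x\to y$, $\theta_2(x,y)=((x\to y)\to y)\to x$. Then: \begin{enumerate} \item $J$ is semi-abelian: $J\vdash e\to e\approx e$ and $J\vdash e*e\approx e$ (pointed with respect to $e$); $J\vdash x*e\approx x$; and $J\vdash\theta_1(x,x)\approx e$, $J\vdash\theta_2(x,x)\approx e$, $J\vdash\theta(y,\theta_1(x,y),\theta_2(x,y))\approx x$. \item In every $J$-algebra the relation $a\le b$ (i.e. $a\to b=e$) is reflexive and anti-symmetric, and $J\vdash x\le y\Rightarrow (x\to y)\to y\approx y$ (i.e. in every $J$-algebra, $a\to b=e$ implies $(a\to b)\to b=b$). \end{enumerate}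
   Context: $J\vdash\phi$ means the equation $\phi$ is derivable from $J$ by equational logic, equivalently holds in all $J$-algebras. A theory is semi-abelian if it is pointed (there is a constant $c$ with $f(c,\dots,c)\approx c$ provable for every operation symbol $f$) and protomodular (there exist terms $\theta(x_0,\dots,x_n)$ and binary $\theta_1,\dots,\theta_n$ with $\theta_i(x,x)$ provably equal to constant terms and $\theta(y,\theta_1(x,y),\dots,\theta_n(x,y))\approx x$ provable). -}

module Defs where

open import Level using (Level; suc)
open import Relation.Binary.PropositionalEquality using (_≡_)

record JAlgebra (a : Level) : Set (suc a) where
  infixr 6 _⇒_
  infixl 5 _✶_
  field
    Carrier : Set a
    _✶_     : Carrier → Carrier → Carrier
    _⇒_     : Carrier → Carrier → Carrier
    e       : Carrier
    ax-refl : ∀ x → (x ⇒ x) ≡ e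
    ax-unit : ∀ x → (e ⇒ x) ≡ x
    ax-prot : ∀ x y → (((x ⇒ y) ⇒ y) ✶ (((x ⇒ y) ⇒ y) ⇒ x)) ≡ x

  _≤_ : Carrier → Carrier → Set a
  x ≤ y = (x ⇒ y) ≡ e

  θ : Carrier → Carrier → Carrier → Carrier
  θ x₀ x₁ x₂ = (x₁ ⇒ x₀) ✶ x₂

  θ₁ : Carrier → Carrier → Carrier
  θ₁ x y = x ⇒ y

  θ₂ : Carrier → Carrier → Carrier
  θ₂ x y = ((x ⇒ y) ⇒ y) ⇒ x

{-# OPTIONS --safe #-}
module Submission where

open import Defs
open import Level using (Level)
open import Data.Product using (_×_; _,_)
open import Relation.Binary.PropositionalEquality using (_≡_; cong; cong₂; module ≡-Reasoning)

module JAlgebraProperties {a : Level} (A : JAlgebra a) where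

  open JAlgebra A
  open ≡-Reasoning

  [x⇒x]⇒x≡x : ∀ x → ((x ⇒ x) ⇒ x) ≡ x
  [x⇒x]⇒x≡x x = begin
    (x ⇒ x) ⇒ x  ≡⟨ cong (_⇒ x) (ax-refl x) ⟩
    e ⇒ x        ≡⟨ ax-unit x ⟩
    x            ∎

  θ₂-diagonal : ∀ x → θ₂ x x ≡ e
  θ₂-diagonal x = begin
    ((x ⇒ x) ⇒ x) ⇒ x  ≡⟨ cong (_⇒ x) ([x⇒x]⇒x≡x x) ⟩
    x ⇒ x              ≡⟨ ax-refl x ⟩
    e                  ∎

  ✶-identityʳ : ∀ x → (x ✶ e) ≡ x
  ✶-identityʳ x = begin
    x ✶ e                                    ≡⟨ cong₂ _✶_ ([x⇒x]⇒x≡x x) (θ₂-diagonal x) ⟨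
    ((x ⇒ x) ⇒ x) ✶ (((x ⇒ x) ⇒ x) ⇒ x)      ≡⟨ ax-prot x x ⟩
    x                                        ∎

  ≤⇒[x⇒y]⇒y≡y : ∀ {x y} → x ≤ y → ((x ⇒ y) ⇒ y) ≡ y
  ≤⇒[x⇒y]⇒y≡y {x} {y} x≤y = begin
    (x ⇒ y) ⇒ y  ≡⟨ cong (_⇒ y) x≤y ⟩
    e ⇒ y        ≡⟨ ax-unit y ⟩
    y            ∎

  ≤-antisym : ∀ {x y} → x ≤ y → y ≤ x → x ≡ y
  ≤-antisym {x} {y} x≤y y≤x = begin
    x                                        ≡⟨ ax-prot x y ⟨
    ((x ⇒ y) ⇒ y) ✶ (((x ⇒ y) ⇒ y) ⇒ x)      ≡⟨ cong (λ z → z ✶ (z ⇒ x)) (≤⇒[x⇒y]⇒y≡y x≤y) ⟩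
    y ✶ (y ⇒ x)                              ≡⟨ cong (y ✶_) y≤x ⟩
    y ✶ e                                    ≡⟨ ✶-identityʳ y ⟩
    y                                        ∎

mainTheorem6 : ∀ {a : Level} (A : JAlgebra a) → let open JAlgebra A in
    (((e ⇒ e) ≡ e) × ((e ✶ e) ≡ e) × (∀ x → (x ✶ e) ≡ x)
      × (∀ x → θ₁ x x ≡ e) × (∀ x → θ₂ x x ≡ e)
      × (∀ x y → θ y (θ₁ x y) (θ₂ x y) ≡ x))
    × ((∀ x → x ≤ x) × (∀ x y → x ≤ y → y ≤ x → x ≡ y)
      × (∀ x y → x ≤ y → ((x ⇒ y) ⇒ y) ≡ y))
mainTheorem6 A =
  ( (ax-refl e , ✶-identityʳ e , ✶-identityʳ , ax-refl , θ₂-diagonal , ax-prot)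
  , (ax-refl , (λ _ _ → ≤-antisym) , (λ _ _ → ≤⇒[x⇒y]⇒y≡y)) )
  where
  open JAlgebra A
  open JAlgebraProperties A
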